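{- Let $k \geq 1$ be an integer and let $C_1,\dots,C_k, D_1,\dots,D_{k-1}$ be positive integers. (1) If $C_1 \geq D_1 \geq C_2 \geq D_2 \geq \cdots \geq C_{k-1} \geq D_{k-1}$, and $$C := \sum_{i=1}^{k-1} \prod_{j=1}^{i} C_{k-j} + C_{k-1}C_{k-2}\cdots C_1 \sum_{i=1}^{k-1} \prod_{j=1}^{i} D_j,\qquad D := \sum_{i=1}^{k-1} \prod_{j=1}^{i} D_{k-j} + D_{k-1}D_{k-2}\cdots D_1 \sum_{i=1}^{k-1} \prod_{j=1}^{i} C_j,$$ then $C \geq D$. (2) If $C_1 \geq D_1 \geq C_2 \geq \cdots \geq C_{k-1} \geq D_{k-1} \geq C_k$, and $$C' := \sum_{i=0}^{k-1} \prod_{j=0}^{i} C_{k-j} + C_kC_{k-1}\cdots C_1 \sum_{i=1}^{k-1} \prod_{j=1}^{i} D_j,\qquad D' := \sum_{i=1}^{k-1} \prod_{j=1}^{i} D_{k-j} + D_{k-1}\cdots D_1 \sum_{i=1}^{k} \prod_{j=1}^{i} C_j,$$ then $D' \geq C'$.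
   Context: Empty sums are $0$ and empty products are $1$. -}

module Defs where

open import Data.Nat using (ℕ; zero; suc; _+_; _*_)

sumFrom : ℕ → ℕ → (ℕ → ℕ) → ℕ
sumFrom a zero    f = 0
sumFrom a (suc n) f = f a + sumFrom (suc a) n f

prodFrom : ℕ → ℕ → (ℕ → ℕ) → ℕ
prodFrom a zero    f = 1
prodFrom a (suc n) f = f a * prodFrom (suc a) n f

-- ∑_{i=lo}^{hi} f i  (0 if hi < lo)
sumR : ℕ → ℕ → (ℕ → ℕ) → ℕ
sumR lo hi f = sumFrom lo (suc hi Data.Nat.∸ lo) f

-- ∏_{j=lo}^{hi} f j  (1 if hi < lo)
prodR : ℕ → ℕ → (ℕ → ℕ) → ℕ
prodR lo hi f = prodFrom lo (suc hi Data.Nat.∸ lo) f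

-- With n = k − 1 both inequalities hold term by term.  The sums of products of
-- the reversed sequences are compared factor by factor (D_{k−j} ≤ C_{k−j} in (1),
-- C_{k−j} ≤ D_{k−j−1} in (2)).  In the remaining part, distribute the leading
-- product over the sum: each term is then an exchange
--   ∏_{j≤n} D_j · ∏_{j≤i} C_j  ≤  ∏_{j≤n} C_j · ∏_{j≤i} D_j      (i ≤ n),
-- true because only the factors with j > i differ, or in (2) its interlaced form
--   ∏_{j≤k} C_j · ∏_{j≤i} D_j  ≤  ∏_{j≤n} D_j · ∏_{j≤i+1} C_j,
-- which at i = 0 also absorbs the one surplus term ∏_{j≤k} C_j of C′.
module Submission where

open import Defs
open import Data.Nat using (ℕ; zero; suc; _+_; _*_; _∸_; _≤_; _<_; z≤n; s≤s)
open import Data.Nat.Properties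
open import Data.Product using (_×_; _,_)
open import Relation.Binary.PropositionalEquality
open import Function using (_$_)
open import Algebra.Properties.CommutativeSemigroup *-commutativeSemigroup using (interchange)

record Pointwise≤ (f g : ℕ → ℕ) (m a b : ℕ) : Set where
  constructor pointwise≤
  field at : ∀ t → t < m → f (a + t) ≤ g (b + t)

module _ {f g : ℕ → ℕ} where

  Pointwise≤-head : ∀ {m a b} → Pointwise≤ f g (suc m) a b → f a ≤ g b
  Pointwise≤-head {a = a} {b} (pointwise≤ h) =
    subst₂ (λ x y → f x ≤ g y) (+-identityʳ a) (+-identityʳ b) (h 0 (s≤s z≤n))

  Pointwise≤-tail : ∀ {m a b} → Pointwise≤ f g (suc m) a b → Pointwise≤ f g m (suc a) (suc b)
  Pointwise≤-tail {a = a} {b} (pointwise≤ h) = pointwise≤ λ t t<m →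
    subst₂ (λ x y → f x ≤ g y) (+-suc a t) (+-suc b t) (h (suc t) (s≤s t<m))

  Pointwise≤-restrict : ∀ {m n a b} → m ≤ n → Pointwise≤ f g n a b → Pointwise≤ f g m a b
  Pointwise≤-restrict m≤n (pointwise≤ h) = pointwise≤ λ t t<m → h t (≤-trans t<m m≤n)

  prodFrom-mono-≤ : ∀ {m a b} → Pointwise≤ f g m a b → prodFrom a m f ≤ prodFrom b m g
  prodFrom-mono-≤ {zero}  h = ≤-refl
  prodFrom-mono-≤ {suc m} h = *-mono-≤ (Pointwise≤-head h) (prodFrom-mono-≤ (Pointwise≤-tail h))

  sumFrom-mono-≤ : ∀ {m a b} → Pointwise≤ f g m a b → sumFrom a m f ≤ sumFrom b m g
  sumFrom-mono-≤ {zero}  h = ≤-refl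
  sumFrom-mono-≤ {suc m} h = +-mono-≤ (Pointwise≤-head h) (sumFrom-mono-≤ (Pointwise≤-tail h))

*-distribˡ-sumFrom : ∀ c m a (f : ℕ → ℕ) → c * sumFrom a m f ≡ sumFrom a m (λ i → c * f i)
*-distribˡ-sumFrom c zero    a f = *-zeroʳ c
*-distribˡ-sumFrom c (suc m) a f =
  trans (*-distribˡ-+ c (f a) _) (cong (c * f a +_) (*-distribˡ-sumFrom c m (suc a) f))

*-sumFrom-mono-≤ : ∀ c d {m a b} {f g : ℕ → ℕ}
  → Pointwise≤ (λ i → c * f i) (λ i → d * g i) m a b
  → c * sumFrom a m f ≤ d * sumFrom b m g
*-sumFrom-mono-≤ c d {m} {a} {b} {f} {g} h =
  subst₂ _≤_ (sym (*-distribˡ-sumFrom c m a f)) (sym (*-distribˡ-sumFrom d m b g))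
    (sumFrom-mono-≤ h)

sumFrom-snoc : ∀ m a (f : ℕ → ℕ) → sumFrom a (suc m) f ≡ sumFrom a m f + f (a + m)
sumFrom-snoc zero    a f = trans (+-identityʳ (f a)) (cong f (sym (+-identityʳ a)))
sumFrom-snoc (suc m) a f = begin
    f a + sumFrom (suc a) (suc m) f
  ≡⟨ cong (f a +_) (sumFrom-snoc m (suc a) f) ⟩
    f a + (sumFrom (suc a) m f + f (suc a + m))
  ≡⟨ sym (+-assoc (f a) _ _) ⟩
    f a + sumFrom (suc a) m f + f (suc a + m)
  ≡⟨ cong (λ x → f a + sumFrom (suc a) m f + f x) (sym (+-suc a m)) ⟩
    f a + sumFrom (suc a) m f + f (a + suc m)
  ∎
  where open ≡-Reasoning

prodFrom-snoc : ∀ m a (f : ℕ → ℕ) → prodFrom a (suc m) f ≡ prodFrom a m f * f (a + m)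
prodFrom-snoc zero    a f = trans (*-comm (f a) 1) (cong (λ x → 1 * f x) (sym (+-identityʳ a)))
prodFrom-snoc (suc m) a f = begin
    f a * prodFrom (suc a) (suc m) f
  ≡⟨ cong (f a *_) (prodFrom-snoc m (suc a) f) ⟩
    f a * (prodFrom (suc a) m f * f (suc a + m))
  ≡⟨ sym (*-assoc (f a) _ _) ⟩
    f a * prodFrom (suc a) m f * f (suc a + m)
  ≡⟨ cong (λ x → f a * prodFrom (suc a) m f * f x) (sym (+-suc a m)) ⟩
    f a * prodFrom (suc a) m f * f (a + suc m)
  ∎
  where open ≡-Reasoning

prodFrom-suc : ∀ m a (f : ℕ → ℕ) → prodFrom (suc a) m f ≡ prodFrom a m (λ i → f (suc i))
prodFrom-suc zero    a f = refl
prodFrom-suc (suc m) a f = cong (f (suc a) *_) (prodFrom-suc m (suc a) f)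

prodFrom-reverse : ∀ m (f : ℕ → ℕ) → prodFrom 0 m (λ j → f (m ∸ j)) ≡ prodFrom 1 m f
prodFrom-reverse zero    f = refl
prodFrom-reverse (suc m) f = begin
    f (suc m) * prodFrom 1 m (λ j → f (suc m ∸ j))
  ≡⟨ cong (f (suc m) *_) (prodFrom-suc m 0 (λ j → f (suc m ∸ j))) ⟩
    f (suc m) * prodFrom 0 m (λ j → f (m ∸ j))
  ≡⟨ cong (f (suc m) *_) (prodFrom-reverse m f) ⟩
    f (suc m) * prodFrom 1 m f
  ≡⟨ *-comm (f (suc m)) _ ⟩
    prodFrom 1 m f * f (suc m)
  ≡⟨ sym (prodFrom-snoc m 1 f) ⟩
    prodFrom 1 (suc m) f
  ∎
  where open ≡-Reasoning

prodFrom-exchange-≤ : ∀ {a n i} {f g : ℕ → ℕ} → i ≤ n → Pointwise≤ f g n a a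
  → prodFrom a n f * prodFrom a i g ≤ prodFrom a n g * prodFrom a i f
prodFrom-exchange-≤ {i = zero} _ h = *-monoˡ-≤ 1 (prodFrom-mono-≤ h)
prodFrom-exchange-≤ {a} {suc n} {suc i} {f} {g} (s≤s i≤n) h = begin
    (f a * prodFrom (suc a) n f) * (g a * prodFrom (suc a) i g)
  ≡⟨ interchange (f a) _ (g a) _ ⟩
    (f a * g a) * (prodFrom (suc a) n f * prodFrom (suc a) i g)
  ≤⟨ *-mono-≤ (≤-reflexive (*-comm (f a) (g a)))
              (prodFrom-exchange-≤ i≤n (Pointwise≤-tail h)) ⟩
    (g a * f a) * (prodFrom (suc a) n g * prodFrom (suc a) i f)
  ≡⟨ interchange (g a) _ (f a) _ ⟨
    (g a * prodFrom (suc a) n g) * (f a * prodFrom (suc a) i f)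
  ∎
  where open ≤-Reasoning

prodFrom-interlace-≤ : ∀ {a n i} {f g : ℕ → ℕ} → i ≤ n → Pointwise≤ g f n (suc a) a
  → prodFrom a (suc n) g * prodFrom a i f ≤ prodFrom a n f * prodFrom a (suc i) g
prodFrom-interlace-≤ {a} {n} {zero} {f} {g} _ h = begin
    g a * prodFrom (suc a) n g * 1
  ≡⟨ *-identityʳ _ ⟩
    g a * prodFrom (suc a) n g
  ≤⟨ *-monoʳ-≤ (g a) (prodFrom-mono-≤ h) ⟩
    g a * prodFrom a n f
  ≡⟨ *-comm (g a) _ ⟩
    prodFrom a n f * g a
  ≡⟨ cong (prodFrom a n f *_) (*-identityʳ (g a)) ⟨
    prodFrom a n f * (g a * 1)
  ∎
  where open ≤-Reasoning
prodFrom-interlace-≤ {a} {suc n} {suc i} {f} {g} (s≤s i≤n) h = begin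
    (g a * prodFrom (suc a) (suc n) g) * (f a * prodFrom (suc a) i f)
  ≡⟨ interchange (g a) _ (f a) _ ⟩
    (g a * f a) * (prodFrom (suc a) (suc n) g * prodFrom (suc a) i f)
  ≤⟨ *-mono-≤ (≤-reflexive (*-comm (g a) (f a)))
              (prodFrom-interlace-≤ i≤n (Pointwise≤-tail h)) ⟩
    (f a * g a) * (prodFrom (suc a) n f * prodFrom (suc a) (suc i) g)
  ≡⟨ interchange (f a) _ (g a) _ ⟨
    (f a * prodFrom (suc a) n f) * (g a * prodFrom (suc a) (suc i) g)
  ∎
  where open ≤-Reasoning

module _ (n : ℕ) (C D : ℕ → ℕ) where

  private
    C⃖ D⃖ : ℕ → ℕ
    C⃖ j = C (suc n ∸ j)
    D⃖ j = D (suc n ∸ j)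

  D≤C : (∀ i → 1 ≤ i → i ≤ n → D i ≤ C i)
    → sumFrom 1 n (λ i → prodFrom 1 i D⃖) + prodFrom 1 n D * sumFrom 1 n (λ i → prodFrom 1 i C)
      ≤ sumFrom 1 n (λ i → prodFrom 1 i C⃖) + prodFrom 1 n C * sumFrom 1 n (λ i → prodFrom 1 i D)
  D≤C Dᵢ≤Cᵢ = +-mono-≤
      (sumFrom-mono-≤ $ pointwise≤ λ t t<n → prodFrom-mono-≤ (Pointwise≤-restrict t<n reversed))
      (*-sumFrom-mono-≤ (prodFrom 1 n D) (prodFrom 1 n C) $ pointwise≤ λ t t<n →
        prodFrom-exchange-≤ t<n forward)
    where
    forward : Pointwise≤ D C n 1 1
    forward = pointwise≤ λ t t<n → Dᵢ≤Cᵢ (suc t) (s≤s z≤n) t<n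

    reversed : Pointwise≤ D⃖ C⃖ n 1 1
    reversed = pointwise≤ λ s s<n → Dᵢ≤Cᵢ (n ∸ s) (m<n⇒0<n∸m s<n) (m∸n≤m n s)

  C′≤D′ : (∀ i → 1 ≤ i → i ≤ n → C (i + 1) ≤ D i)
    → sumFrom 0 (suc n) (λ i → prodFrom 0 (suc i) C⃖)
        + prodFrom 1 (suc n) C * sumFrom 1 n (λ i → prodFrom 1 i D)
      ≤ sumFrom 1 n (λ i → prodFrom 1 i D⃖)
        + prodFrom 1 n D * sumFrom 1 (suc n) (λ i → prodFrom 1 i C)
  C′≤D′ Cᵢ₊₁≤Dᵢ = begin
      sumFrom 0 (suc n) F + ΠC * ΣD
    ≡⟨ cong (_+ ΠC * ΣD) (sumFrom-snoc n 0 F) ⟩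
      sumFrom 0 n F + F n + ΠC * ΣD
    ≤⟨ +-mono-≤ (+-mono-≤ reversedSum lastTerm) remainingSum ⟩
      ΣD⃖ + ΠD * P 1 + ΠD * sumFrom 2 n P
    ≡⟨ +-assoc ΣD⃖ _ _ ⟩
      ΣD⃖ + (ΠD * P 1 + ΠD * sumFrom 2 n P)
    ≡⟨ cong (ΣD⃖ +_) (*-distribˡ-+ ΠD _ _) ⟨
      ΣD⃖ + ΠD * sumFrom 1 (suc n) P
    ∎
    where
    open ≤-Reasoning

    F P : ℕ → ℕ
    F i = prodFrom 0 (suc i) C⃖
    P i = prodFrom 1 i C

    ΠC ΠD ΣD ΣD⃖ : ℕ
    ΠC  = prodFrom 1 (suc n) C
    ΠD  = prodFrom 1 n D
    ΣD  = sumFrom 1 n (λ i → prodFrom 1 i D)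
    ΣD⃖ = sumFrom 1 n (λ i → prodFrom 1 i D⃖)

    forward : Pointwise≤ C D n 2 1
    forward = pointwise≤ λ t t<n →
      subst (λ x → C (suc x) ≤ D (suc t)) (+-comm t 1) (Cᵢ₊₁≤Dᵢ (suc t) (s≤s z≤n) t<n)

    reversed : Pointwise≤ C⃖ D⃖ n 0 1
    reversed = pointwise≤ λ s s<n →
      subst (λ x → C x ≤ D (n ∸ s)) (sym (trans (+-∸-assoc 1 (<⇒≤ s<n)) (+-comm 1 (n ∸ s))))
        (Cᵢ₊₁≤Dᵢ (n ∸ s) (m<n⇒0<n∸m s<n) (m∸n≤m n s))

    reversedSum : sumFrom 0 n F ≤ ΣD⃖
    reversedSum = sumFrom-mono-≤ $ pointwise≤ λ t t<n → prodFrom-mono-≤ (Pointwise≤-restrict t<n reversed)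

    lastTerm : F n ≤ ΠD * P 1
    lastTerm = begin
        F n
      ≡⟨ prodFrom-reverse (suc n) C ⟩
        ΠC
      ≡⟨ *-identityʳ ΠC ⟨
        ΠC * 1
      ≤⟨ prodFrom-interlace-≤ z≤n forward ⟩
        ΠD * P 1
      ∎

    remainingSum : ΠC * ΣD ≤ ΠD * sumFrom 2 n P
    remainingSum = *-sumFrom-mono-≤ ΠC ΠD $ pointwise≤ λ t t<n → prodFrom-interlace-≤ t<n forward

lemma2p8 : (k : ℕ) → 1 ≤ k → (C D : ℕ → ℕ)
    → (∀ i → 1 ≤ i → i ≤ k → 1 ≤ C i)
    → (∀ i → 1 ≤ i → i ≤ k ∸ 1 → 1 ≤ D i)
    → ((∀ i → 1 ≤ i → i ≤ k ∸ 1 → D i ≤ C i)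
        → (∀ i → 1 ≤ i → i + 1 ≤ k ∸ 1 → C (i + 1) ≤ D i)
        → sumR 1 (k ∸ 1) (λ i → prodR 1 i (λ j → D (k ∸ j)))
            + prodR 1 (k ∸ 1) D * sumR 1 (k ∸ 1) (λ i → prodR 1 i C)
          ≤ sumR 1 (k ∸ 1) (λ i → prodR 1 i (λ j → C (k ∸ j)))
            + prodR 1 (k ∸ 1) C * sumR 1 (k ∸ 1) (λ i → prodR 1 i D))
    × ((∀ i → 1 ≤ i → i ≤ k ∸ 1 → D i ≤ C i)
        → (∀ i → 1 ≤ i → i ≤ k ∸ 1 → C (i + 1) ≤ D i)
        → sumR 0 (k ∸ 1) (λ i → prodR 0 i (λ j → C (k ∸ j)))
            + prodR 1 k C * sumR 1 (k ∸ 1) (λ i → prodR 1 i D)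
          ≤ sumR 1 (k ∸ 1) (λ i → prodR 1 i (λ j → D (k ∸ j)))
            + prodR 1 (k ∸ 1) D * sumR 1 k (λ i → prodR 1 i C))
lemma2p8 (suc n) _ C D _ _ = (λ Dᵢ≤Cᵢ _ → D≤C n C D Dᵢ≤Cᵢ)
                           , (λ _ Cᵢ₊₁≤Dᵢ → C′≤D′ n C D Cᵢ₊₁≤Dᵢ)
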